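{- Let $m\ge 2$ and let $L_1=x_1x_2\cdots x_k$ and $L_2=y_1y_2\cdots y_k$ be words over the alphabet $\{1,\dots,m\}$. Suppose there is a bijection (permutation) $b:\{1,\dots,m\}\to\{1,\dots,m\}$ with $b(x_i)=y_i$ for all $1\le i\le k$. For an $m$-ary tree $T$ with word representation $W(T)$, let $B_{L_1,L_2}(T)$ be the $m$-ary tree whose word representation is obtained from $W(T)$ by replacing every letter $i$ in every word by $b(i)$. Then $B_{L_1,L_2}$ maps the set of $m$-ary trees avoiding the pattern $P(L_1)$ to the set of $m$-ary trees avoiding the pattern $P(L_2)$, and this map is one-to-one, onto, and preserves the number of leaves. In particular, for every $n$, the number of $n$-leaf $m$-ary trees avoiding $P(L_1)$ equals the number of $n$-leaf $m$-ary trees avoiding $P(L_2)$.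
   Context: An $m$-ary tree is a rooted ordered (plane) tree in which every vertex has either $0$ children (a leaf) or exactly $m$ ordered children (an internal vertex); the children of an internal vertex are labeled $1,\dots,m$ from left to right. Any word $x_1\cdots x_j$ over $\{1,\dots,m\}$ describes a path from the root: go to the child labeled $x_1$ of the root, then to the child labeled $x_2$ of that vertex, and so on. An $m$-leaf parent is an internal vertex all of whose $m$ children are leaves. The word representation $W(T)$ of an $m$-ary tree $T$ is the set of words describing the paths from the root to the $m$-leaf parents of $T$; this set determines $T$ uniquely (the single-vertex tree corresponds to the empty set, the tree with one internal vertex to $\{\epsilon\}$), and conversely any finite set of words in which no word is a prefix of another is the word representation of a unique $m$-ary tree (the tree whose internal vertices are exactly the vertices reached by prefixes of words in the set). For a word $L$, $P(L)$ denotes the $m$-ary tree pattern with word representation $\{L\}$, i.e. the tree whose internal vertices are exactly those reached by prefixes of $L$. A tree $T$ contains a tree pattern $t$ if there is a vertex $v$ of $T$ such that, placing the root of $t$ at $v$ and matching children in order, every internal vertex of $t$ corresponds to an internal vertex of $T$ (i.e. $t$ occurs as a contiguous, rooted, ordered subtree of $T$); otherwise $T$ avoids $t$. -}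

module Defs where

open import Data.Nat using (ℕ; zero; suc; _+_; _≤_)
open import Data.Fin using (Fin; zero; suc; _≟_)
open import Data.Vec using (Vec; []; _∷_; lookup; tabulate)
open import Data.List using (List; []; _∷_; _++_; map; mapMaybe; length)
open import Data.Nat.ListAction using (sum)
open import Data.Maybe using (Maybe; just; nothing)
open import Data.Bool using (Bool; true; false; _∧_)
open import Data.Product using (Σ; _×_; _,_)
open import Data.Fin.Permutation using (Permutation′; _⟨$⟩ʳ_)
open import Relation.Nullary using (¬_; yes; no)
open import Relation.Binary.PropositionalEquality using (_≡_)

-- m-ary trees: a leaf, or an internal vertex with exactly m ordered
-- children (child i is the child labelled i, Fin m standing for {1..m}).
data Tree (m : ℕ) : Set where
  leaf : Tree m
  node : Vec (Tree m) m → Tree m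

Word : ℕ → Set
Word m = List (Fin m)

module _ {m : ℕ} where

  isLeaf : Tree m → Bool
  isLeaf leaf     = true
  isLeaf (node _) = false

  allLeaves : ∀ {k} → Vec (Tree m) k → Bool
  allLeaves []       = true
  allLeaves (t ∷ ts) = isLeaf t ∧ allLeaves ts

  mutual
    leaves : Tree m → ℕ
    leaves leaf      = 1
    leaves (node ts) = leavesV ts

    leavesV : ∀ {k} → Vec (Tree m) k → ℕ
    leavesV []       = 0
    leavesV (t ∷ ts) = leaves t + leavesV ts

  -- word representation W(T): words of paths from the root to the
  -- m-leaf parents (listed left to right).
  mutual
    W : Tree m → List (Word m)
    W leaf      = []
    W (node ts) with allLeaves ts
    ... | true  = [] ∷ []
    ... | false = WV (λ i → i) ts

    WV : ∀ {k} → (Fin k → Fin m) → Vec (Tree m) k → List (Word m)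
    WV lab []       = []
    WV lab (t ∷ ts) = map (lab zero ∷_) (W t) ++ WV (λ i → lab (suc i)) ts

  strip : Fin m → Word m → Maybe (Word m)
  strip i []      = nothing
  strip i (j ∷ w) with i ≟ j
  ... | yes _ = just w
  ... | no  _ = nothing

  -- tree whose internal vertices are exactly the vertices reached by
  -- prefixes of words in the given set (fuel bounds the depth)
  fromWordsF : ℕ → List (Word m) → Tree m
  fromWordsF _       []         = leaf
  fromWordsF zero    (_ ∷ _)    = leaf
  fromWordsF (suc n) ws@(_ ∷ _) = node (tabulate (λ i → fromWordsF n (mapMaybe (strip i) ws)))

  fromWords : List (Word m) → Tree m
  fromWords ws = fromWordsF (suc (sum (map length ws))) ws

  P : Word m → Tree m
  P L = fromWords (L ∷ [])

  data Matches : Tree m → Tree m → Set where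
    leafM : ∀ {T} → Matches leaf T
    nodeM : ∀ {ts us} → (∀ i → Matches (lookup ts i) (lookup us i)) → Matches (node ts) (node us)

  data Contains (t : Tree m) : Tree m → Set where
    here  : ∀ {T} → Matches t T → Contains t T
    there : ∀ {us} (i : Fin m) → Contains t (lookup us i) → Contains t (node us)

  Avoids : Tree m → Tree m → Set
  Avoids t T = ¬ Contains t T

  B : Permutation′ m → Tree m → Tree m
  B b T = fromWords (map (map (b ⟨$⟩ʳ_)) (W T))

-- Renaming the letters of all words by a permutation b is, on trees, the
-- operation of permuting the children of every internal vertex: the child
-- labelled i moves to position b i. This relabelling of trees is invertible,
-- it maps occurrences of a pattern t to occurrences of the relabelled pattern,
-- the relabelled P(L₁) is P(L₂), and permuting children does not change the
-- number of leaves. The only work is to check that the word-level definition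
-- of B agrees with the tree-level relabelling, i.e. that fromWords inverts W.
module Submission where

open import Defs
open import Data.Nat using (ℕ; zero; suc; _+_; _≤_; _<_; s≤s)
open import Data.Nat.Properties
  using (≤-refl; ≤-trans; m≤m+n; m≤n+m; +-commutativeSemigroup; +-0-commutativeMonoid)
open import Data.Nat.ListAction using (sum)
open import Data.Nat.ListAction.Properties using (sum-++)
open import Data.Fin using (Fin; zero; suc; _≟_)
open import Data.Fin.Properties using (0≢1+n; suc-injective)
open import Data.Fin.Permutation using (Permutation′; _⟨$⟩ʳ_; _⟨$⟩ˡ_; inverseˡ; inverseʳ; flip)
open import Data.Vec using (Vec; []; _∷_; lookup; tabulate)
open import Data.Vec.Properties using (lookup∘tabulate; tabulate∘lookup; tabulate-cong)
open import Data.List using (List; []; _∷_; _++_; map; mapMaybe; length)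
open import Data.List.Properties using (length-map; map-∘; map-cong; map-++; mapMaybe-++; ++-identityʳ; ++-conicalˡ; ++-conicalʳ)
open import Data.Bool using (true; false)
open import Data.Empty using (⊥-elim)
open import Data.Product using (Σ; _×_; _,_)
open import Function using (_∘_)
open import Function.Definitions using (Injective)
open import Relation.Nullary using (yes; no; contradiction)
open import Relation.Binary.PropositionalEquality
  using (_≡_; _≢_; refl; sym; trans; cong; cong₂; subst; subst₂; module ≡-Reasoning)
open import Algebra.Properties.CommutativeSemigroup +-commutativeSemigroup using (x∙yz≈y∙xz)
open import Algebra.Properties.CommutativeMonoid.Sum +-0-commutativeMonoid
  using (sum-permute; sum-cong-≗) renaming (sum to ∑)

module _ {m : ℕ} where

  module _ (Q : Tree m → Set) (Q-leaf : Q leaf)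
           (Q-node : ∀ ts → (∀ i → Q (lookup ts i)) → Q (node ts)) where
    mutual
      tree-ind : ∀ T → Q T
      tree-ind leaf      = Q-leaf
      tree-ind (node ts) = Q-node ts (tree-indV ts)

      tree-indV : ∀ {k} (ts : Vec (Tree m) k) (i : Fin k) → Q (lookup ts i)
      tree-indV (t ∷ ts) zero    = tree-ind t
      tree-indV (t ∷ ts) (suc i) = tree-indV ts i

  node-cong : ∀ {ts us : Vec (Tree m) m} → (∀ i → lookup ts i ≡ lookup us i) → node ts ≡ node us
  node-cong {ts} {us} eq = cong node (begin
    ts                     ≡⟨ tabulate∘lookup ts ⟨
    tabulate (lookup ts)   ≡⟨ tabulate-cong eq ⟩
    tabulate (lookup us)   ≡⟨ tabulate∘lookup us ⟩
    us                     ∎)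
    where open ≡-Reasoning

  mutual
    relabel : (Fin m → Fin m) → Tree m → Tree m
    relabel g leaf      = leaf
    relabel g (node ts) = node (tabulate (lookup (relabelV g ts) ∘ g))

    relabelV : ∀ {k} → (Fin m → Fin m) → Vec (Tree m) k → Vec (Tree m) k
    relabelV g []       = []
    relabelV g (t ∷ ts) = relabel g t ∷ relabelV g ts

  lookup-relabelV : ∀ g {k} (ts : Vec (Tree m) k) i → lookup (relabelV g ts) i ≡ relabel g (lookup ts i)
  lookup-relabelV g (t ∷ ts) zero    = refl
  lookup-relabelV g (t ∷ ts) (suc i) = lookup-relabelV g ts i

  lookup-relabel : ∀ g ts j → lookup (tabulate (lookup (relabelV g ts) ∘ g)) j ≡ relabel g (lookup ts (g j))
  lookup-relabel g ts j = trans (lookup∘tabulate _ j) (lookup-relabelV g ts (g j))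

  relabel-inverse : ∀ {g h : Fin m → Fin m} → (∀ j → h (g j) ≡ j) → ∀ T → relabel g (relabel h T) ≡ T
  relabel-inverse {g} {h} h∘g≗id = tree-ind (λ T → relabel g (relabel h T) ≡ T) refl step
    where
    step : ∀ ts → (∀ i → relabel g (relabel h (lookup ts i)) ≡ lookup ts i)
         → relabel g (relabel h (node ts)) ≡ node ts
    step ts ih = node-cong λ j → begin
      lookup (tabulate (lookup (relabelV g hts) ∘ g)) j ≡⟨ lookup-relabel g hts j ⟩
      relabel g (lookup hts (g j))                      ≡⟨ cong (relabel g) (lookup-relabel h ts (g j)) ⟩
      relabel g (relabel h (lookup ts (h (g j))))       ≡⟨ cong (relabel g ∘ relabel h ∘ lookup ts) (h∘g≗id j) ⟩
      relabel g (relabel h (lookup ts j))               ≡⟨ ih j ⟩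
      lookup ts j                                       ∎
      where
      open ≡-Reasoning
      hts = tabulate (lookup (relabelV h ts) ∘ h)

  relabel-matches : ∀ g {t T} → Matches t T → Matches (relabel g t) (relabel g T)
  relabel-matches g leafM                 = leafM
  relabel-matches g (nodeM {ts} {us} ms) =
    nodeM λ j → subst₂ Matches (sym (lookup-relabel g ts j)) (sym (lookup-relabel g us j))
                               (relabel-matches g (ms (g j)))

  relabel-contains : ∀ {g f : Fin m → Fin m} → (∀ i → g (f i) ≡ i) → ∀ {t T} → Contains t T → Contains (relabel g t) (relabel g T)
  relabel-contains {g} g∘f≗id (here ms) = here (relabel-matches g ms)
  relabel-contains {g} {f} g∘f≗id {t} (there {us} i c) =
    there (f i) (subst (Contains (relabel g t)) (sym child) (relabel-contains {g} {f} g∘f≗id c))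
    where
    child : lookup (tabulate (lookup (relabelV g us) ∘ g)) (f i) ≡ relabel g (lookup us i)
    child = trans (lookup-relabel g us (f i)) (cong (relabel g ∘ lookup us) (g∘f≗id i))

  leavesV≡∑ : ∀ {k} (ts : Vec (Tree m) k) → leavesV ts ≡ ∑ (leaves ∘ lookup ts)
  leavesV≡∑ []       = refl
  leavesV≡∑ (t ∷ ts) = cong (leaves t +_) (leavesV≡∑ ts)

  leaves-relabel : (π : Permutation′ m) → ∀ T → leaves (relabel (π ⟨$⟩ʳ_) T) ≡ leaves T
  leaves-relabel π = tree-ind (λ T → leaves (relabel g T) ≡ leaves T) refl step
    where
    g = π ⟨$⟩ʳ_
    step : ∀ ts → (∀ i → leaves (relabel g (lookup ts i)) ≡ leaves (lookup ts i))
         → leaves (relabel g (node ts)) ≡ leaves (node ts)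
    step ts ih = begin
      leavesV gts                                    ≡⟨ leavesV≡∑ gts ⟩
      ∑ (leaves ∘ lookup gts)                        ≡⟨ sum-cong-≗ (λ j → trans (cong leaves (lookup-relabel g ts j)) (ih (g j))) ⟩
      ∑ (leaves ∘ lookup ts ∘ g)                     ≡⟨ sum-permute (leaves ∘ lookup ts) π ⟨
      ∑ (leaves ∘ lookup ts)                         ≡⟨ leavesV≡∑ ts ⟨
      leavesV ts                                     ∎
      where
      open ≡-Reasoning
      gts = tabulate (lookup (relabelV g ts) ∘ g)

  fromWordsF-[] : ∀ n → fromWordsF {m} n [] ≡ leaf
  fromWordsF-[] zero    = refl
  fromWordsF-[] (suc n) = refl

  module _ {f g : Fin m → Fin m} (g∘f≗id : ∀ x → g (f x) ≡ x) (f∘g≗id : ∀ j → f (g j) ≡ j) where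

    strip-map : ∀ j (ws : List (Word m)) →
                mapMaybe (strip j) (map (map f) ws) ≡ map (map f) (mapMaybe (strip (g j)) ws)
    strip-map j []             = refl
    strip-map j ([] ∷ ws)      = strip-map j ws
    strip-map j ((x ∷ w) ∷ ws) with j ≟ f x | g j ≟ x
    ... | yes _     | yes _     = cong (map f w ∷_) (strip-map j ws)
    ... | no _      | no _      = strip-map j ws
    ... | yes j≡fx  | no gj≢x   = ⊥-elim (gj≢x (trans (cong g j≡fx) (g∘f≗id x)))
    ... | no j≢fx   | yes gj≡x  = ⊥-elim (j≢fx (trans (sym (f∘g≗id j)) (cong f gj≡x)))

    fromWordsF-map : ∀ n ws → fromWordsF n (map (map f) ws) ≡ relabel g (fromWordsF n ws)
    fromWordsF-map n       []       = trans (fromWordsF-[] n) (cong (relabel g) (sym (fromWordsF-[] n)))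
    fromWordsF-map zero    (w ∷ ws) = refl
    fromWordsF-map (suc n) ws@(_ ∷ _) = node-cong λ j → begin
      lookup (tabulate (λ i → fromWordsF n (mapMaybe (strip i) (map (map f) ws)))) j
        ≡⟨ lookup∘tabulate _ j ⟩
      fromWordsF n (mapMaybe (strip j) (map (map f) ws))
        ≡⟨ cong (fromWordsF n) (strip-map j ws) ⟩
      fromWordsF n (map (map f) (mapMaybe (strip (g j)) ws))
        ≡⟨ fromWordsF-map n _ ⟩
      relabel g (fromWordsF n (mapMaybe (strip (g j)) ws))
        ≡⟨ cong (relabel g) (lookup∘tabulate _ (g j)) ⟨
      relabel g (lookup children (g j))
        ≡⟨ lookup-relabel g children j ⟨
      lookup (tabulate (lookup (relabelV g children) ∘ g)) j
        ∎
      where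
      open ≡-Reasoning
      children = tabulate (λ i → fromWordsF n (mapMaybe (strip i) ws))

    fromWords-map : ∀ ws → fromWords (map (map f) ws) ≡ relabel g (fromWords ws)
    fromWords-map ws = trans (cong (λ n → fromWordsF (suc n) (map (map f) ws)) fuel-eq) (fromWordsF-map _ ws)
      where
      fuel-eq : sum (map length (map (map f) ws)) ≡ sum (map length ws)
      fuel-eq = cong sum (trans (sym (map-∘ ws)) (map-cong (length-map f) ws))

  totalLength : List (Word m) → ℕ
  totalLength ws = sum (map length ws)

  totalLength-++ : ∀ xs ys → totalLength (xs ++ ys) ≡ totalLength xs + totalLength ys
  totalLength-++ xs ys = trans (cong sum (map-++ length xs ys)) (sum-++ (map length xs) (map length ys))

  totalLength-prefix : ∀ c ws → totalLength (map (c ∷_) ws) ≡ length ws + totalLength ws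
  totalLength-prefix c []       = refl
  totalLength-prefix c (w ∷ ws) =
    cong suc (trans (cong (length w +_) (totalLength-prefix c ws)) (x∙yz≈y∙xz (length w) (length ws) _))

  strip-prefix : ∀ c (ws : List (Word m)) → mapMaybe (strip c) (map (c ∷_) ws) ≡ ws
  strip-prefix c []       = refl
  strip-prefix c (w ∷ ws) with c ≟ c
  ... | yes _  = cong (w ∷_) (strip-prefix c ws)
  ... | no c≢c = contradiction refl c≢c

  strip-other-prefix : ∀ {c i} → c ≢ i → (ws : List (Word m)) → mapMaybe (strip i) (map (c ∷_) ws) ≡ []
  strip-other-prefix c≢i []       = refl
  strip-other-prefix {c} {i} c≢i (w ∷ ws) with i ≟ c
  ... | yes i≡c = contradiction (sym i≡c) c≢i
  ... | no _    = strip-other-prefix c≢i ws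

  strip-WV-unused : ∀ {k} (lab : Fin k → Fin m) {i} → (∀ j → lab j ≢ i) → ∀ ts → mapMaybe (strip i) (WV lab ts) ≡ []
  strip-WV-unused lab unused []       = refl
  strip-WV-unused lab {i} unused (t ∷ ts) = begin
    mapMaybe (strip i) (map (lab zero ∷_) (W t) ++ WV (lab ∘ suc) ts)
      ≡⟨ mapMaybe-++ (strip i) (map (lab zero ∷_) (W t)) _ ⟩
    mapMaybe (strip i) (map (lab zero ∷_) (W t)) ++ mapMaybe (strip i) (WV (lab ∘ suc) ts)
      ≡⟨ cong₂ _++_ (strip-other-prefix (unused zero) (W t)) (strip-WV-unused (lab ∘ suc) (unused ∘ suc) ts) ⟩
    []  ∎
    where open ≡-Reasoning

  strip-WV : ∀ {k} (lab : Fin k → Fin m) → Injective _≡_ _≡_ lab → ∀ ts j →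
             mapMaybe (strip (lab j)) (WV lab ts) ≡ W (lookup ts j)
  strip-WV lab inj (t ∷ ts) j = begin
    mapMaybe (strip (lab j)) (map (lab zero ∷_) (W t) ++ WV (lab ∘ suc) ts)
      ≡⟨ mapMaybe-++ (strip (lab j)) (map (lab zero ∷_) (W t)) _ ⟩
    mapMaybe (strip (lab j)) (map (lab zero ∷_) (W t)) ++ mapMaybe (strip (lab j)) (WV (lab ∘ suc) ts)
      ≡⟨ split j ⟩
    W (lookup (t ∷ ts) j)  ∎
    where
    open ≡-Reasoning
    0≢suc : ∀ j → lab zero ≢ lab (suc j)
    0≢suc j eq = 0≢1+n (inj eq)
    split : ∀ j → mapMaybe (strip (lab j)) (map (lab zero ∷_) (W t)) ++ mapMaybe (strip (lab j)) (WV (lab ∘ suc) ts)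
                ≡ W (lookup (t ∷ ts) j)
    split zero    = trans (cong₂ _++_ (strip-prefix (lab zero) (W t))
                                      (strip-WV-unused (lab ∘ suc) (λ j → 0≢suc j ∘ sym) ts))
                          (++-identityʳ (W t))
    split (suc j) = cong₂ _++_ (strip-other-prefix (0≢suc j) (W t))
                               (strip-WV (lab ∘ suc) (suc-injective ∘ inj) ts j)

  totalLength-WV : ∀ {k} (lab : Fin k → Fin m) ts j →
                   length (W (lookup ts j)) + totalLength (W (lookup ts j)) ≤ totalLength (WV lab ts)
  totalLength-WV lab (t ∷ ts) j rewrite totalLength-++ (map (lab zero ∷_) (W t)) (WV (lab ∘ suc) ts) with j
  ... | zero  rewrite totalLength-prefix (lab zero) (W t) = m≤m+n _ _
  ... | suc j = ≤-trans (totalLength-WV (lab ∘ suc) ts j) (m≤n+m _ _)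

  allLeaves⇒leaf : ∀ {k} (ts : Vec (Tree m) k) → allLeaves ts ≡ true → ∀ i → lookup ts i ≡ leaf
  allLeaves⇒leaf (leaf ∷ ts)   eq zero    = refl
  allLeaves⇒leaf (leaf ∷ ts)   eq (suc i) = allLeaves⇒leaf ts eq i
  allLeaves⇒leaf (node _ ∷ ts) () i

  leaf⇒allLeaves : ∀ {k} (ts : Vec (Tree m) k) → (∀ i → lookup ts i ≡ leaf) → allLeaves ts ≡ true
  leaf⇒allLeaves []       _      = refl
  leaf⇒allLeaves (t ∷ ts) allLeaf with allLeaf zero
  ... | refl = leaf⇒allLeaves ts (allLeaf ∘ suc)

  WV≡[]⇒W≡[] : ∀ {k} (lab : Fin k → Fin m) ts → WV lab ts ≡ [] → ∀ i → W (lookup ts i) ≡ []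
  WV≡[]⇒W≡[] lab (t ∷ ts) eq zero with W t | ++-conicalˡ (map (lab zero ∷_) (W t)) _ eq
  ... | [] | _ = refl
  WV≡[]⇒W≡[] lab (t ∷ ts) eq (suc i) = WV≡[]⇒W≡[] (lab ∘ suc) ts (++-conicalʳ (map (lab zero ∷_) (W t)) _ eq) i

  W≡[]⇒leaf : ∀ T → W T ≡ [] → T ≡ leaf
  W≡[]⇒leaf = tree-ind (λ T → W T ≡ [] → T ≡ leaf) (λ _ → refl) step
    where
    step : ∀ ts → (∀ i → W (lookup ts i) ≡ [] → lookup ts i ≡ leaf) → W (node ts) ≡ [] → node ts ≡ leaf
    step ts ih W≡[] with allLeaves ts in allLeaves≡false
    step ts ih () | true
    ... | false = contradiction
      (trans (sym allLeaves≡false) (leaf⇒allLeaves ts (λ i → ih i (WV≡[]⇒W≡[] (λ i → i) ts W≡[] i))))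
      λ ()

  fromWordsF-suc : ∀ n (ws : List (Word m)) → ws ≢ [] →
                   fromWordsF (suc n) ws ≡ node (tabulate (λ i → fromWordsF n (mapMaybe (strip i) ws)))
  fromWordsF-suc n []      ws≢[] = contradiction refl ws≢[]
  fromWordsF-suc n (_ ∷ _) _     = refl

  -- In W (node ts) every word of a child gains a letter, so a child that is
  -- not a leaf has strictly smaller total length: this pays for one level.
  fromWordsF-W : ∀ T n → totalLength (W T) < n → fromWordsF n (W T) ≡ T
  fromWordsF-W = tree-ind (λ T → ∀ n → totalLength (W T) < n → fromWordsF n (W T) ≡ T)
                          (λ n _ → fromWordsF-[] n) step
    where
    child : ∀ n t → (∀ n → totalLength (W t) < n → fromWordsF n (W t) ≡ t) →
            length (W t) + totalLength (W t) ≤ n → fromWordsF n (W t) ≡ t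
    child n t ih le with W t in W≡ | ih
    ... | []     | _  = trans (fromWordsF-[] n) (sym (W≡[]⇒leaf t W≡))
    ... | w ∷ ws | ih = ih n (≤-trans (s≤s (m≤n+m (totalLength (w ∷ ws)) (length ws))) le)

    step : ∀ ts → (∀ i n → totalLength (W (lookup ts i)) < n → fromWordsF n (W (lookup ts i)) ≡ lookup ts i)
         → ∀ n → totalLength (W (node ts)) < n → fromWordsF n (W (node ts)) ≡ node ts
    step ts ih n lt with allLeaves ts in allLeaves≡ | W≡[]⇒leaf (node ts)
    step ts ih (suc n) lt | true | _ =
      node-cong λ i → trans (lookup∘tabulate _ i) (trans (fromWordsF-[] n) (sym (allLeaves⇒leaf ts allLeaves≡ i)))
    step ts ih (suc n) (s≤s le) | false | nonLeaf =
      trans (fromWordsF-suc n (WV (λ i → i) ts) (λ WV≡[] → contradiction (nonLeaf WV≡[]) λ ()))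
            (node-cong λ i → trans (lookup∘tabulate _ i)
              (trans (cong (fromWordsF n) (strip-WV (λ i → i) (λ eq → eq) ts i))
                     (child n (lookup ts i) (ih i) (≤-trans (totalLength-WV (λ i → i) ts i) le))))

  fromWords-W : ∀ T → fromWords (W T) ≡ T
  fromWords-W T = fromWordsF-W T _ ≤-refl

module _ {m : ℕ} (b : Permutation′ m) where

  private
    bʳ bˡ : Fin m → Fin m
    bʳ = b ⟨$⟩ʳ_
    bˡ = b ⟨$⟩ˡ_

    bˡ∘bʳ≗id : ∀ i → bˡ (bʳ i) ≡ i
    bˡ∘bʳ≗id _ = inverseˡ b

    bʳ∘bˡ≗id : ∀ i → bʳ (bˡ i) ≡ i
    bʳ∘bˡ≗id _ = inverseʳ b

  B⁻¹ : Tree m → Tree m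
  B⁻¹ = relabel bʳ

  B≡relabel : ∀ T → B b T ≡ relabel bˡ T
  B≡relabel T = trans (fromWords-map bˡ∘bʳ≗id bʳ∘bˡ≗id (W T)) (cong (relabel bˡ) (fromWords-W T))

  P-map : ∀ L → P (map bʳ L) ≡ relabel bˡ (P L)
  P-map L = fromWords-map bˡ∘bʳ≗id bʳ∘bˡ≗id (L ∷ [])

  B⁻¹-B : ∀ T → B⁻¹ (B b T) ≡ T
  B⁻¹-B T = trans (cong B⁻¹ (B≡relabel T)) (relabel-inverse bˡ∘bʳ≗id T)

  B-B⁻¹ : ∀ U → B b (B⁻¹ U) ≡ U
  B-B⁻¹ U = trans (B≡relabel (B⁻¹ U)) (relabel-inverse bʳ∘bˡ≗id U)

  B-injective : ∀ {T T′} → B b T ≡ B b T′ → T ≡ T′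
  B-injective {T} {T′} eq = trans (sym (B⁻¹-B T)) (trans (cong B⁻¹ eq) (B⁻¹-B T′))

  B-avoids : ∀ L T → Avoids (P L) T → Avoids (P (map bʳ L)) (B b T)
  B-avoids L T avoids c =
    avoids (subst₂ Contains (relabel-inverse bˡ∘bʳ≗id (P L)) (relabel-inverse bˡ∘bʳ≗id T)
      (relabel-contains {g = bʳ} {f = bˡ} bʳ∘bˡ≗id (subst₂ Contains (P-map L) (B≡relabel T) c)))

  B⁻¹-avoids : ∀ L U → Avoids (P (map bʳ L)) U → Avoids (P L) (B⁻¹ U)
  B⁻¹-avoids L U avoids c =
    avoids (subst₂ Contains (sym (P-map L)) (relabel-inverse bʳ∘bˡ≗id U)
      (relabel-contains {g = bˡ} {f = bʳ} bˡ∘bʳ≗id c))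

  leaves-B : ∀ T → leaves (B b T) ≡ leaves T
  leaves-B T = trans (cong leaves (B≡relabel T)) (leaves-relabel (flip b) T)

  leaves-B⁻¹ : ∀ U → leaves (B⁻¹ U) ≡ leaves U
  leaves-B⁻¹ = leaves-relabel b

theorem1 : (m : ℕ) → 2 ≤ m → (L₁ L₂ : List (Fin m)) → (b : Permutation′ m)
    → map (b ⟨$⟩ʳ_) L₁ ≡ L₂
    → ((T : Tree m) → Avoids (P L₁) T → Avoids (P L₂) (B b T))
    × ((T T′ : Tree m) → Avoids (P L₁) T → Avoids (P L₁) T′ → B b T ≡ B b T′ → T ≡ T′)
    × ((U : Tree m) → Avoids (P L₂) U → Σ (Tree m) (λ T → Avoids (P L₁) T × B b T ≡ U))
    × ((T : Tree m) → Avoids (P L₁) T → leaves (B b T) ≡ leaves T)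
    × ((n : ℕ) → Σ (Tree m → Tree m) (λ f → Σ (Tree m → Tree m) (λ g →
        ((T : Tree m) → Avoids (P L₁) T → leaves T ≡ n
           → Avoids (P L₂) (f T) × leaves (f T) ≡ n × g (f T) ≡ T)
      × ((U : Tree m) → Avoids (P L₂) U → leaves U ≡ n
           → Avoids (P L₁) (g U) × leaves (g U) ≡ n × f (g U) ≡ U))))
theorem1 m _ L₁ _ b refl =
    B-avoids b L₁
  , (λ _ _ _ _ → B-injective b)
  , (λ U avoids → B⁻¹ b U , B⁻¹-avoids b L₁ U avoids , B-B⁻¹ b U)
  , (λ T _ → leaves-B b T)
  , λ n → B b , B⁻¹ b
        , (λ T avoids ≡n → B-avoids b L₁ T avoids , trans (leaves-B b T) ≡n , B⁻¹-B b T)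
        , (λ U avoids ≡n → B⁻¹-avoids b L₁ U avoids , trans (leaves-B⁻¹ b U) ≡n , B-B⁻¹ b U)
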